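{- Let $S\subset\{ -1,0,1\}^2\setminus\{(0,0)\}$ and let $p\in\tilde{\mathcal{Q}}_s\subset\mathbb{Z}^2$ for some $s\in\mathbb{Z}$. Then the map sending a walk $(s_0,p_0),(s_1,p_1),\dots,(s_n,p_n)$ in the spiral space $\Pi$ with $(s_0,p_0)=(s,p)$ to the walk $p_0,p_1,\dots,p_n$ is a bijection between walks in $\Pi$ starting at $(s,p)$ with steps in $S$ and walks in $\mathbb{Z}^2\setminus\{(0,0)\}$ starting at $p$ with steps in $S$, and it preserves the sequence of steps.
   Context: $\tilde{\mathcal{Q}}_0=\{(i,j)\in\mathbb{Z}^2:i>0,j\ge0\}$, $r(a,b)=(-b,a)$, and $\tilde{\mathcal{Q}}_s=r^s(\tilde{\mathcal{Q}}_0)$ for $s\in\mathbb{Z}$ (so $\tilde{\mathcal{Q}}_{s+4}=\tilde{\mathcal{Q}}_s$). The spiral space is $\Pi=\bigcup_{s\in\mathbb{Z}}\{s\}\times\tilde{\mathcal{Q}}_s$. A walk in $\Pi$ with steps in $S$ is a sequence of points of $\Pi$ in which each step from $(s_1,(a_1,b_1))$ to $(s_2,(a_2,b_2))$ satisfies $(a_2-a_1,b_2-b_1)\in S$ and $|s_1-s_2|\le1$; a walk in $\mathbb{Z}^2\setminus\{(0,0)\}$ with steps in $S$ is a sequence of points of $\mathbb{Z}^2\setminus\{(0,0)\}$ whose consecutive differences lie in $S$. -}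

module Defs where

open import Data.Nat as ℕ using (ℕ; zero; suc)
open import Data.Integer using (ℤ; +_; -[1+_]; _-_; -_; ∣_∣; _<_; _≤_; 0ℤ)
open import Data.Product using (Σ; _×_; _,_; proj₁; proj₂)
open import Data.Unit using (⊤)
open import Data.Vec using (Vec; []; _∷_; head; map)
open import Data.Vec.Relation.Unary.All using (All)
open import Relation.Binary.PropositionalEquality using (_≡_)
open import Relation.Nullary using (¬_)

Point : Set
Point = ℤ × ℤ

r : Point → Point
r (a , b) = (- b , a)

r⁻¹ : Point → Point
r⁻¹ (a , b) = (b , - a)

iterate : (Point → Point) → ℕ → Point → Point
iterate f zero    x = x
iterate f (suc n) x = f (iterate f n x)

rpow : ℤ → Point → Point
rpow (+ n)     = iterate r n
rpow -[1+ n ]  = iterate r⁻¹ (suc n)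

Q₀ : Point → Set
Q₀ (i , j) = (0ℤ < i) × (0ℤ ≤ j)

InQ : ℤ → Point → Set
InQ s p = Σ Point (λ q → Q₀ q × rpow s q ≡ p)

InΠ : ℤ × Point → Set
InΠ (s , p) = InQ s p

AllowedStep : Point → Set
AllowedStep (a , b) = (∣ a ∣ ℕ.≤ 1) × (∣ b ∣ ℕ.≤ 1) × ¬ ((a , b) ≡ (0ℤ , 0ℤ))

diff : Point → Point → Point
diff (a₁ , b₁) (a₂ , b₂) = (a₂ - a₁ , b₂ - b₁)

Chain : {A : Set} → (A → A → Set) → {n : ℕ} → Vec A (suc n) → Set
Chain R (x ∷ [])     = ⊤
Chain R (x ∷ y ∷ xs) = R x y × Chain R (y ∷ xs)

ΠStep : (Point → Set) → ℤ × Point → ℤ × Point → Set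
ΠStep S (s₁ , p₁) (s₂ , p₂) = S (diff p₁ p₂) × (∣ s₁ - s₂ ∣ ℕ.≤ 1)

IsΠWalk : (Point → Set) → ℤ → Point → {n : ℕ} → Vec (ℤ × Point) (suc n) → Set
IsΠWalk S s p w = (head w ≡ (s , p)) × All InΠ w × Chain (ΠStep S) w

NonOrigin : Point → Set
NonOrigin p = ¬ (p ≡ (0ℤ , 0ℤ))

IsZWalk : (Point → Set) → Point → {n : ℕ} → Vec Point (suc n) → Set
IsZWalk S p v = (head v ≡ p) × All NonOrigin v × Chain (λ a b → S (diff a b)) v

forget : {n : ℕ} → Vec (ℤ × Point) n → Vec Point n
forget = map proj₂

steps : {n : ℕ} → Vec Point (suc n) → Vec Point n
steps (x ∷ [])     = []
steps (x ∷ y ∷ xs) = diff x y ∷ steps (y ∷ xs)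

stepsΠ : {n : ℕ} → Vec (ℤ × Point) (suc n) → Vec Point n
stepsΠ (x ∷ [])     = []
stepsΠ (x ∷ y ∷ xs) = diff (proj₂ x) (proj₂ y) ∷ stepsΠ (y ∷ xs)

-- ℤ² ∖ {0} is the disjoint union of four quarter-planes, one for each class of s mod 4, and Q̃ₛ is the
-- quarter-plane of the class of s. A step in {-1,0,1}² never joins two opposite quarter-planes, so the
-- point reached by a step lies in the quarter-plane of exactly one of s - 1, s, s + 1. Hence the
-- sheet index of a walk in Π is determined step by step by its projection, and every walk in
-- ℤ² ∖ {0} lifts.
module Submission where

open import Defs
open import Data.Nat using (ℕ; suc)
open import Data.Integer using (ℤ)
open import Data.Product using (Σ; _×_; _,_)
open import Data.Vec using (Vec)
open import Relation.Binary.PropositionalEquality using (_≡_)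

open import Data.Empty using (⊥-elim)
open import Data.Integer
  using (+_; -[1+_]; _+_; _-_; 0ℤ; 1ℤ; -1ℤ; ∣_∣; _<_; _≤_; +≤+; -≤+; +<+; -<+)
  renaming (suc to sucℤ; pred to predℤ)
open import Data.Integer.Properties
  using (neg-involutive; neg-mono-≤; neg-mono-<; <⇒≱; <-asym; ∣i-j∣≡∣j-i∣; +-inverseʳ; +-identityʳ; +-comm)
open import Data.Integer.Tactic.RingSolver using (solve-∀)
import Data.Nat as ℕ
open import Data.Nat.GeneralisedArithmetic using (fold)
open import Data.Product using (proj₁; proj₂)
open import Data.Unit using (tt)
open import Data.Vec using (_∷_; []; map)
open import Data.Vec.Properties using (∷-injective)
open import Data.Vec.Relation.Unary.All using (All; _∷_; [])
import Data.Vec.Relation.Unary.All as All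
open import Data.Vec.Relation.Unary.All.Properties using (map⁺)
open import Function using (id)
open import Relation.Binary.PropositionalEquality using (refl; sym; trans; cong; subst; _≢_; module ≡-Reasoning)
open import Relation.Nullary using (¬_)

data Quadrant : Set where
  Q0 Q1 Q2 Q3 : Quadrant

rotate : Quadrant → Quadrant
rotate Q0 = Q1
rotate Q1 = Q2
rotate Q2 = Q3
rotate Q3 = Q0

rotate⁻¹ : Quadrant → Quadrant
rotate⁻¹ Q0 = Q3
rotate⁻¹ Q1 = Q0
rotate⁻¹ Q2 = Q1
rotate⁻¹ Q3 = Q2

opposite : Quadrant → Quadrant
opposite c = rotate (rotate c)

rotate∘rotate⁻¹ : ∀ c → rotate (rotate⁻¹ c) ≡ c
rotate∘rotate⁻¹ Q0 = refl
rotate∘rotate⁻¹ Q1 = refl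
rotate∘rotate⁻¹ Q2 = refl
rotate∘rotate⁻¹ Q3 = refl

rotate⁻¹∘rotate : ∀ c → rotate⁻¹ (rotate c) ≡ c
rotate⁻¹∘rotate Q0 = refl
rotate⁻¹∘rotate Q1 = refl
rotate⁻¹∘rotate Q2 = refl
rotate⁻¹∘rotate Q3 = refl

-- InQuadrant c is r^c(Q̃₀), for c read as an exponent mod 4.
InQuadrant : Quadrant → Point → Set
InQuadrant Q0 p       = Q₀ p
InQuadrant Q1 (x , y) = (x ≤ 0ℤ) × (0ℤ < y)
InQuadrant Q2 (x , y) = (x < 0ℤ) × (y ≤ 0ℤ)
InQuadrant Q3 (x , y) = (0ℤ ≤ x) × (y < 0ℤ)

r-InQuadrant : ∀ {c p} → InQuadrant c p → InQuadrant (rotate c) (r p)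
r-InQuadrant {Q0} (x>0 , y≥0) = neg-mono-≤ y≥0 , x>0
r-InQuadrant {Q1} (x≤0 , y>0) = neg-mono-< y>0 , x≤0
r-InQuadrant {Q2} (x<0 , y≤0) = neg-mono-≤ y≤0 , x<0
r-InQuadrant {Q3} (x≥0 , y<0) = neg-mono-< y<0 , x≥0

r⁻¹-InQuadrant : ∀ {c p} → InQuadrant c p → InQuadrant (rotate⁻¹ c) (r⁻¹ p)
r⁻¹-InQuadrant {Q0} (x>0 , y≥0) = y≥0 , neg-mono-< x>0
r⁻¹-InQuadrant {Q1} (x≤0 , y>0) = y>0 , neg-mono-≤ x≤0
r⁻¹-InQuadrant {Q2} (x<0 , y≤0) = y≤0 , neg-mono-< x<0
r⁻¹-InQuadrant {Q3} (x≥0 , y<0) = y<0 , neg-mono-≤ x≥0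

r-InQuadrant-rotate⁻¹ : ∀ {c p} → InQuadrant (rotate⁻¹ c) p → InQuadrant c (r p)
r-InQuadrant-rotate⁻¹ {c} {p} h = subst (λ d → InQuadrant d (r p)) (rotate∘rotate⁻¹ c) (r-InQuadrant h)

r⁻¹-InQuadrant-rotate : ∀ {c p} → InQuadrant (rotate c) p → InQuadrant c (r⁻¹ p)
r⁻¹-InQuadrant-rotate {c} {p} h = subst (λ d → InQuadrant d (r⁻¹ p)) (rotate⁻¹∘rotate c) (r⁻¹-InQuadrant h)

r∘r⁻¹ : ∀ p → r (r⁻¹ p) ≡ p
r∘r⁻¹ (x , y) = cong (_, y) (neg-involutive x)

r⁻¹∘r : ∀ p → r⁻¹ (r p) ≡ p
r⁻¹∘r (x , y) = cong (x ,_) (neg-involutive y)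

InQuadrant-unique : ∀ {c d p} → InQuadrant c p → InQuadrant d p → c ≡ d
InQuadrant-unique {Q0} {Q0} _ _ = refl
InQuadrant-unique {Q1} {Q1} _ _ = refl
InQuadrant-unique {Q2} {Q2} _ _ = refl
InQuadrant-unique {Q3} {Q3} _ _ = refl
InQuadrant-unique {Q0} {Q1} (x>0 , _) (x≤0 , _) = ⊥-elim (<⇒≱ x>0 x≤0)
InQuadrant-unique {Q0} {Q2} (x>0 , _) (x<0 , _) = ⊥-elim (<-asym x>0 x<0)
InQuadrant-unique {Q0} {Q3} (_ , y≥0) (_ , y<0) = ⊥-elim (<⇒≱ y<0 y≥0)
InQuadrant-unique {Q1} {Q0} (x≤0 , _) (x>0 , _) = ⊥-elim (<⇒≱ x>0 x≤0)
InQuadrant-unique {Q1} {Q2} (_ , y>0) (_ , y≤0) = ⊥-elim (<⇒≱ y>0 y≤0)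
InQuadrant-unique {Q1} {Q3} (_ , y>0) (_ , y<0) = ⊥-elim (<-asym y>0 y<0)
InQuadrant-unique {Q2} {Q0} (x<0 , _) (x>0 , _) = ⊥-elim (<-asym x>0 x<0)
InQuadrant-unique {Q2} {Q1} (_ , y≤0) (_ , y>0) = ⊥-elim (<⇒≱ y>0 y≤0)
InQuadrant-unique {Q2} {Q3} (x<0 , _) (x≥0 , _) = ⊥-elim (<⇒≱ x<0 x≥0)
InQuadrant-unique {Q3} {Q0} (_ , y<0) (_ , y≥0) = ⊥-elim (<⇒≱ y<0 y≥0)
InQuadrant-unique {Q3} {Q1} (_ , y<0) (_ , y>0) = ⊥-elim (<-asym y>0 y<0)
InQuadrant-unique {Q3} {Q2} (x≥0 , _) (x<0 , _) = ⊥-elim (<⇒≱ x<0 x≥0)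

InQuadrant⇒NonOrigin : ∀ {c p} → InQuadrant c p → NonOrigin p
InQuadrant⇒NonOrigin {Q0} (+<+ () , _) refl
InQuadrant⇒NonOrigin {Q1} (_ , +<+ ()) refl
InQuadrant⇒NonOrigin {Q2} (+<+ () , _) refl
InQuadrant⇒NonOrigin {Q3} (_ , +<+ ()) refl

NonOrigin⇒InQuadrant : ∀ {p} → NonOrigin p → Σ Quadrant (λ c → InQuadrant c p)
NonOrigin⇒InQuadrant {+ 0       , + 0}       p≢0 = ⊥-elim (p≢0 refl)
NonOrigin⇒InQuadrant {+ 0       , + suc n}   _   = Q1 , +≤+ ℕ.z≤n , +<+ (ℕ.s≤s ℕ.z≤n)
NonOrigin⇒InQuadrant {+ suc m   , + n}       _   = Q0 , +<+ (ℕ.s≤s ℕ.z≤n) , +≤+ ℕ.z≤n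
NonOrigin⇒InQuadrant {+ m       , -[1+ n ]}  _   = Q3 , +≤+ ℕ.z≤n , -<+
NonOrigin⇒InQuadrant { -[1+ m ]  , + suc n}   _   = Q1 , -≤+ , +<+ (ℕ.s≤s ℕ.z≤n)
NonOrigin⇒InQuadrant { -[1+ m ]  , + 0}       _   = Q2 , -<+ , +≤+ ℕ.z≤n
NonOrigin⇒InQuadrant { -[1+ m ]  , -[1+ n ]}  _   = Q2 , -<+ , -≤+

∣neg-pos∣≰1 : ∀ {a b} → a < 0ℤ → 0ℤ < b → ¬ (∣ a - b ∣ ℕ.≤ 1)
∣neg-pos∣≰1 {+ _}      (+<+ ())
∣neg-pos∣≰1 { -[1+ _ ]} {+ 0}     _ (+<+ ())
∣neg-pos∣≰1 { -[1+ _ ]} {+ suc _} _ _ (ℕ.s≤s ())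

∣pos-neg∣≰1 : ∀ {a b} → 0ℤ < a → b < 0ℤ → ¬ (∣ a - b ∣ ℕ.≤ 1)
∣pos-neg∣≰1 {a} {b} a>0 b<0 h = ∣neg-pos∣≰1 b<0 a>0 (subst (ℕ._≤ 1) (∣i-j∣≡∣j-i∣ a b) h)

step-not-opposite : ∀ {c p q} → InQuadrant c p → AllowedStep (diff p q) → ¬ InQuadrant (opposite c) q
step-not-opposite {Q0} (x>0 , _) (∣dx∣≤1 , _)      (x′<0 , _) = ∣neg-pos∣≰1 x′<0 x>0 ∣dx∣≤1
step-not-opposite {Q1} (_ , y>0) (_ , ∣dy∣≤1 , _)  (_ , y′<0) = ∣neg-pos∣≰1 y′<0 y>0 ∣dy∣≤1
step-not-opposite {Q2} (x<0 , _) (∣dx∣≤1 , _)      (x′>0 , _) = ∣pos-neg∣≰1 x′>0 x<0 ∣dx∣≤1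
step-not-opposite {Q3} (_ , y<0) (_ , ∣dy∣≤1 , _)  (_ , y′>0) = ∣pos-neg∣≰1 y′>0 y<0 ∣dy∣≤1

quadrant : ℤ → Quadrant
quadrant (+ n)     = fold Q0 rotate n
quadrant -[1+ n ]  = fold Q0 rotate⁻¹ (suc n)

quadrant-suc : ∀ s → quadrant (sucℤ s) ≡ rotate (quadrant s)
quadrant-suc (+ n)          = refl
quadrant-suc -[1+ 0 ]       = refl
quadrant-suc -[1+ suc n ]   = sym (rotate∘rotate⁻¹ (quadrant -[1+ n ]))

quadrant-pred : ∀ s → quadrant (predℤ s) ≡ rotate⁻¹ (quadrant s)
quadrant-pred (+ 0)      = refl
quadrant-pred (+ suc n)  = sym (rotate⁻¹∘rotate (quadrant (+ n)))
quadrant-pred -[1+ n ]   = refl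

module _ (f : Point → Point) (g : Quadrant → Quadrant)
         (f-InQuadrant : ∀ {c p} → InQuadrant c p → InQuadrant (g c) (f p)) where

  iterate-InQuadrant : ∀ n {c p} → InQuadrant c p → InQuadrant (fold c g n) (iterate f n p)
  iterate-InQuadrant 0       h = h
  iterate-InQuadrant (suc n) h = f-InQuadrant (iterate-InQuadrant n h)

module _ (f f⁻¹ : Point → Point) (g : Quadrant → Quadrant) (f∘f⁻¹ : ∀ p → f (f⁻¹ p) ≡ p)
         (f⁻¹-InQuadrant : ∀ {c p} → InQuadrant (g c) p → InQuadrant c (f⁻¹ p)) where

  iterate-InQuadrant⁻¹ : ∀ n {c p} → InQuadrant (fold c g n) p →
    Σ Point (λ q → InQuadrant c q × iterate f n q ≡ p)
  iterate-InQuadrant⁻¹ 0       {p = p} h = p , h , refl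
  iterate-InQuadrant⁻¹ (suc n) {p = p} h with iterate-InQuadrant⁻¹ n (f⁻¹-InQuadrant h)
  ... | q , q∈c , fⁿq≡f⁻¹p = q , q∈c , trans (cong f fⁿq≡f⁻¹p) (f∘f⁻¹ p)

InQ⇒InQuadrant : ∀ s {p} → InQ s p → InQuadrant (quadrant s) p
InQ⇒InQuadrant (+ n)    (_ , q∈Q₀ , refl) = iterate-InQuadrant r rotate r-InQuadrant n q∈Q₀
InQ⇒InQuadrant -[1+ n ] (_ , q∈Q₀ , refl) = iterate-InQuadrant r⁻¹ rotate⁻¹ r⁻¹-InQuadrant (suc n) q∈Q₀

InQuadrant⇒InQ : ∀ s {p} → InQuadrant (quadrant s) p → InQ s p
InQuadrant⇒InQ (+ n)    = iterate-InQuadrant⁻¹ r r⁻¹ rotate r∘r⁻¹ r⁻¹-InQuadrant-rotate n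
InQuadrant⇒InQ -[1+ n ] = iterate-InQuadrant⁻¹ r⁻¹ r rotate⁻¹ r⁻¹∘r r-InQuadrant-rotate⁻¹ (suc n)

InΠ⇒NonOrigin : ∀ {x} → InΠ x → NonOrigin (proj₂ x)
InΠ⇒NonOrigin {s , _} p∈ = InQuadrant⇒NonOrigin (InQ⇒InQuadrant s p∈)

data Offset : Set where
  stay up down : Offset

shiftℤ : Offset → ℤ → ℤ
shiftℤ stay = id
shiftℤ up   = sucℤ
shiftℤ down = predℤ

shiftQ : Offset → Quadrant → Quadrant
shiftQ stay = id
shiftQ up   = rotate
shiftQ down = rotate⁻¹

quadrant-shift : ∀ o s → quadrant (shiftℤ o s) ≡ shiftQ o (quadrant s)
quadrant-shift stay s = refl
quadrant-shift up   s = quadrant-suc s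
quadrant-shift down s = quadrant-pred s

-- Only meaningful when d is not opposite to c; there it returns the junk value stay.
offset : Quadrant → Quadrant → Offset
offset Q0 Q1 = up
offset Q1 Q2 = up
offset Q2 Q3 = up
offset Q3 Q0 = up
offset Q1 Q0 = down
offset Q2 Q1 = down
offset Q3 Q2 = down
offset Q0 Q3 = down
offset _  _  = stay

offset-shiftQ : ∀ o c → offset c (shiftQ o c) ≡ o
offset-shiftQ stay Q0 = refl
offset-shiftQ stay Q1 = refl
offset-shiftQ stay Q2 = refl
offset-shiftQ stay Q3 = refl
offset-shiftQ up   Q0 = refl
offset-shiftQ up   Q1 = refl
offset-shiftQ up   Q2 = refl
offset-shiftQ up   Q3 = refl
offset-shiftQ down Q0 = refl
offset-shiftQ down Q1 = refl
offset-shiftQ down Q2 = refl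
offset-shiftQ down Q3 = refl

shiftQ-offset : ∀ c d → d ≢ opposite c → shiftQ (offset c d) c ≡ d
shiftQ-offset Q0 Q0 _ = refl
shiftQ-offset Q0 Q1 _ = refl
shiftQ-offset Q0 Q3 _ = refl
shiftQ-offset Q1 Q0 _ = refl
shiftQ-offset Q1 Q1 _ = refl
shiftQ-offset Q1 Q2 _ = refl
shiftQ-offset Q2 Q1 _ = refl
shiftQ-offset Q2 Q2 _ = refl
shiftQ-offset Q2 Q3 _ = refl
shiftQ-offset Q3 Q0 _ = refl
shiftQ-offset Q3 Q2 _ = refl
shiftQ-offset Q3 Q3 _ = refl
shiftQ-offset Q0 Q2 d≢ = ⊥-elim (d≢ refl)
shiftQ-offset Q1 Q3 d≢ = ⊥-elim (d≢ refl)
shiftQ-offset Q2 Q0 d≢ = ⊥-elim (d≢ refl)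
shiftQ-offset Q3 Q1 d≢ = ⊥-elim (d≢ refl)

i-[1+i]≡-1 : ∀ i → i - (1ℤ + i) ≡ -1ℤ
i-[1+i]≡-1 = solve-∀

i-[-1+i]≡1 : ∀ i → i - (-1ℤ + i) ≡ 1ℤ
i-[-1+i]≡1 = solve-∀

j≡i-[i-j] : ∀ i j → j ≡ i - (i - j)
j≡i-[i-j] = solve-∀

∣-∣≤1⇒shift : ∀ t u → ∣ t - u ∣ ℕ.≤ 1 → Σ Offset (λ o → u ≡ shiftℤ o t)
∣-∣≤1⇒shift t u _ with t - u | j≡i-[i-j] t u
... | + 0              | eq = stay , trans eq (+-identityʳ t)
... | + 1              | eq = down , trans eq (+-comm t -1ℤ)
... | -[1+ 0 ]         | eq = up   , trans eq (+-comm t 1ℤ)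
∣-∣≤1⇒shift t u (ℕ.s≤s ()) | + suc (suc _) | _
∣-∣≤1⇒shift t u (ℕ.s≤s ()) | -[1+ suc _ ]  | _

shift-∣-∣≤1 : ∀ o t → ∣ t - shiftℤ o t ∣ ℕ.≤ 1
shift-∣-∣≤1 stay t = subst (λ i → ∣ i ∣ ℕ.≤ 1) (sym (+-inverseʳ t)) ℕ.z≤n
shift-∣-∣≤1 up   t = subst (λ i → ∣ i ∣ ℕ.≤ 1) (sym (i-[1+i]≡-1 t)) (ℕ.s≤s ℕ.z≤n)
shift-∣-∣≤1 down t = subst (λ i → ∣ i ∣ ℕ.≤ 1) (sym (i-[-1+i]≡1 t)) (ℕ.s≤s ℕ.z≤n)

InQ-index-unique : ∀ {t a b p} → InQ a p → InQ b p → ∣ t - a ∣ ℕ.≤ 1 → ∣ t - b ∣ ℕ.≤ 1 → a ≡ b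
InQ-index-unique {t} p∈a p∈b ∣t-a∣≤1 ∣t-b∣≤1
  with ∣-∣≤1⇒shift t _ ∣t-a∣≤1 | ∣-∣≤1⇒shift t _ ∣t-b∣≤1
... | o , refl | o′ , refl = cong (λ o → shiftℤ o t) o≡o′
  where
  open ≡-Reasoning

  same-quadrant : shiftQ o (quadrant t) ≡ shiftQ o′ (quadrant t)
  same-quadrant = begin
    shiftQ o (quadrant t)     ≡⟨ quadrant-shift o t ⟨
    quadrant (shiftℤ o t)     ≡⟨ InQuadrant-unique (InQ⇒InQuadrant (shiftℤ o t) p∈a) (InQ⇒InQuadrant (shiftℤ o′ t) p∈b) ⟩
    quadrant (shiftℤ o′ t)    ≡⟨ quadrant-shift o′ t ⟩
    shiftQ o′ (quadrant t)    ∎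

  o≡o′ : o ≡ o′
  o≡o′ = begin
    o                                          ≡⟨ offset-shiftQ o (quadrant t) ⟨
    offset (quadrant t) (shiftQ o (quadrant t))  ≡⟨ cong (offset (quadrant t)) same-quadrant ⟩
    offset (quadrant t) (shiftQ o′ (quadrant t)) ≡⟨ offset-shiftQ o′ (quadrant t) ⟩
    o′                                         ∎

InQ-step : ∀ t q q′ → InQ t q → AllowedStep (diff q q′) → NonOrigin q′ →
  Σ ℤ (λ t′ → InQ t′ q′ × ∣ t - t′ ∣ ℕ.≤ 1)
InQ-step t q q′ q∈ step q′≢0 with NonOrigin⇒InQuadrant q′≢0
... | d , q′∈d = shiftℤ o t , InQuadrant⇒InQ (shiftℤ o t) q′∈ , shift-∣-∣≤1 o t
  where
  o : Offset
  o = offset (quadrant t) d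

  not-opposite : d ≢ opposite (quadrant t)
  not-opposite d≡ = step-not-opposite (InQ⇒InQuadrant t q∈) step (subst (λ e → InQuadrant e q′) d≡ q′∈d)

  q′∈ : InQuadrant (quadrant (shiftℤ o t)) q′
  q′∈ = subst (λ e → InQuadrant e q′)
    (sym (trans (quadrant-shift o t) (shiftQ-offset (quadrant t) d not-opposite))) q′∈d

Chain-map : {A B : Set} (R : A → A → Set) (R′ : B → B → Set) (f : A → B) →
  (∀ {x y} → R x y → R′ (f x) (f y)) → ∀ {n} (xs : Vec A (suc n)) → Chain R xs → Chain R′ (map f xs)
Chain-map R R′ f f-R (x ∷ [])     _         = tt
Chain-map R R′ f f-R (x ∷ y ∷ xs) (xRy , c) = f-R xRy , Chain-map R R′ f f-R (y ∷ xs) c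

stepsΠ≡steps∘forget : ∀ {n} (w : Vec (ℤ × Point) (suc n)) → stepsΠ w ≡ steps (forget w)
stepsΠ≡steps∘forget (x ∷ [])     = refl
stepsΠ≡steps∘forget (x ∷ y ∷ w) = cong (diff (proj₂ x) (proj₂ y) ∷_) (stepsΠ≡steps∘forget (y ∷ w))

forget-injective : ∀ S {n} x (w w′ : Vec (ℤ × Point) n) → All InΠ w → All InΠ w′ →
  Chain (ΠStep S) (x ∷ w) → Chain (ΠStep S) (x ∷ w′) → forget w ≡ forget w′ → w ≡ w′
forget-injective S x [] [] _ _ _ _ _ = refl
forget-injective S (t , _) ((a , p) ∷ w) ((b , p′) ∷ w′) (p∈a ∷ w∈) (p′∈b ∷ w′∈)
  ((_ , ∣t-a∣≤1) , c) ((_ , ∣t-b∣≤1) , c′) eq with ∷-injective eq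
... | refl , eq′ with InQ-index-unique {t} {a} {b} {p} p∈a p′∈b ∣t-a∣≤1 ∣t-b∣≤1
... | refl = cong ((a , p) ∷_) (forget-injective S (a , p) w w′ w∈ w′∈ c c′ eq′)

lift : ∀ S {n} → (∀ d → S d → AllowedStep d) → ∀ t q → InQ t q →
  (v : Vec Point n) → All NonOrigin v → Chain (λ a b → S (diff a b)) (q ∷ v) →
  Σ (Vec (ℤ × Point) n) (λ w → All InΠ w × Chain (ΠStep S) ((t , q) ∷ w) × forget w ≡ v)
lift S S⊆ t q q∈ [] [] _ = [] , [] , tt , refl
lift S S⊆ t q q∈ (q′ ∷ v) (q′≢0 ∷ v≢0) (step , c) with InQ-step t q q′ q∈ (S⊆ _ step) q′≢0
... | t′ , q′∈ , ∣t-t′∣≤1 with lift S S⊆ t′ q′ q′∈ v v≢0 c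
... | w , w∈ , cw , forget-w =
  (t′ , q′) ∷ w , q′∈ ∷ w∈ , ((step , ∣t-t′∣≤1) , cw) , cong (q′ ∷_) forget-w

IsΠWalk⇒IsZWalk : ∀ {S s p n} (w : Vec (ℤ × Point) (suc n)) → IsΠWalk S s p w → IsZWalk S p (forget w)
IsΠWalk⇒IsZWalk {S} w@(_ ∷ _) (refl , w∈ , c) =
  refl , map⁺ (All.map (λ {x} → InΠ⇒NonOrigin {x}) w∈) , Chain-map (ΠStep S) (λ a b → S (diff a b)) proj₂ proj₁ w c

IsΠWalk-unique : ∀ {S s p n} (w w′ : Vec (ℤ × Point) (suc n)) → IsΠWalk S s p w → IsΠWalk S s p w′ →
  forget w ≡ forget w′ → w ≡ w′
IsΠWalk-unique {S} (x ∷ w) (_ ∷ w′) (refl , _ ∷ w∈ , c) (refl , _ ∷ w′∈ , c′) eq =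
  cong (x ∷_) (forget-injective S x w w′ w∈ w′∈ c c′ (proj₂ (∷-injective eq)))

IsZWalk-lift : ∀ {S s p n} → (∀ d → S d → AllowedStep d) → InQ s p →
  (v : Vec Point (suc n)) → IsZWalk S p v → Σ (Vec (ℤ × Point) (suc n)) (λ w → IsΠWalk S s p w × forget w ≡ v)
IsZWalk-lift {S} {s} S⊆ p∈ (q ∷ v) (refl , _ ∷ v≢0 , c) with lift S S⊆ s q p∈ v v≢0 c
... | w , w∈ , cw , forget-w = (s , q) ∷ w , (refl , p∈ ∷ w∈ , cw) , cong (q ∷_) forget-w

lemma5p2 : (S : Point → Set) → (∀ d → S d → AllowedStep d) →
    (s : ℤ) (p : Point) → InQ s p →
    ((n : ℕ) (w : Vec (ℤ × Point) (suc n)) → IsΠWalk S s p w → IsZWalk S p (forget w))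
    × ((n : ℕ) (w w′ : Vec (ℤ × Point) (suc n)) → IsΠWalk S s p w → IsΠWalk S s p w′ →
        forget w ≡ forget w′ → w ≡ w′)
    × ((n : ℕ) (v : Vec Point (suc n)) → IsZWalk S p v →
        Σ (Vec (ℤ × Point) (suc n)) (λ w → IsΠWalk S s p w × forget w ≡ v))
    × ((n : ℕ) (w : Vec (ℤ × Point) (suc n)) → IsΠWalk S s p w → stepsΠ w ≡ steps (forget w))
lemma5p2 S S⊆ s p p∈ =
  (λ _ → IsΠWalk⇒IsZWalk {S}) ,
  (λ _ → IsΠWalk-unique {S}) ,
  (λ _ → IsZWalk-lift {S} S⊆ p∈) ,
  (λ _ w _ → stepsΠ≡steps∘forget w)
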